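{- For all $t,w\in\mathbb{N}$, $\mathrm{R}^{\text{1-way}}(\mathrm{SETINC}^{t+w}_{t,t+w-1})\ge\Omega(\min(t,w))$.
   Context: For $p\le q\le n$, $\mathrm{SETINC}^n_{p,q}$ is the partial function where Alice gets $\mathbf{x}\in\{0,1\}^n$ with $|\mathbf{x}|=p$, Bob gets $\mathbf{y}\in\{0,1\}^n$ with $|\mathbf{y}|=q$, and they must distinguish $|\mathbf{x}\wedge\mathbf{y}|=p$ from $|\mathbf{x}\wedge\mathbf{y}|=p-1$ (undefined otherwise). $\mathrm{R}^{\text{1-way}}$ is public-coin one-way (Alice to Bob) randomized communication complexity with success probability $\ge2/3$ on every input where the function is defined.
   Formalization: The public-coin one-way protocols are taken as distributions over deterministic one-way protocols with rational probabilities only. -}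

module Defs where

open import Data.Bool using (Bool; true; false; _∧_; if_then_else_)
open import Data.Nat using (ℕ; zero; suc; _+_; _*_; _∸_; _≤_)
open import Data.Vec using (Vec; zipWith; count)
open import Data.List using (List; []; _∷_)
open import Data.Product using (_×_; _,_; Σ)
open import Data.Sum using (_⊎_)
open import Relation.Binary.PropositionalEquality using (_≡_)
open import Relation.Nullary.Decidable using (does)
open import Data.Bool.Properties using () renaming (_≟_ to _≟ᵇ_)
open import Data.Nat.Properties using () renaming (_≟_ to _≟ⁿ_)

∣_∣ : ∀ {n} → Vec Bool n → ℕ
∣ x ∣ = count (λ b → b ≟ᵇ true) x

inter : ∀ {n} → Vec Bool n → Vec Bool n → ℕ
inter x y = ∣ zipWith _∧_ x y ∣

-- A partial Boolean function on {0,1}^n × {0,1}^n: a domain predicate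
-- and a value (only meaningful on the domain).
record PartialFn (n : ℕ) : Set₁ where
  field
    Dom : Vec Bool n → Vec Bool n → Set
    val : Vec Bool n → Vec Bool n → Bool
open PartialFn public

SETINC : (n p q : ℕ) → PartialFn n
SETINC n p q = record
  { Dom = λ x y → (∣ x ∣ ≡ p) × (∣ y ∣ ≡ q) × ((inter x y ≡ p) ⊎ (suc (inter x y) ≡ p))
  ; val = λ x y → does (inter x y ≟ⁿ p)
  }

record OneWayDet (n c : ℕ) : Set where
  field
    alice : Vec Bool n → Vec Bool c
    bob   : Vec Bool n → Vec Bool c → Bool
open OneWayDet public

run : ∀ {n c} → OneWayDet n c → Vec Bool n → Vec Bool n → Bool
run P x y = bob P y (alice P x)

-- Public-coin one-way protocol of cost c: a finitely supported distribution
-- over deterministic cost-c one-way protocols, given as a list of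
-- (natural-number weight, protocol) pairs (probability = weight / total).
RandOneWay : ℕ → ℕ → Set
RandOneWay n c = List (ℕ × OneWayDet n c)

totalWeight : ∀ {n c} → RandOneWay n c → ℕ
totalWeight [] = 0
totalWeight ((k , _) ∷ ps) = k + totalWeight ps

weightOut : ∀ {n c} → RandOneWay n c → Vec Bool n → Vec Bool n → Bool → ℕ
weightOut [] x y b = 0
weightOut ((k , P) ∷ ps) x y b =
  (if does (run P x y ≟ᵇ b) then k else 0) + weightOut ps x y b

-- P computes f with success probability ≥ 2/3 on every input in the domain.
Computes : ∀ {n c} → RandOneWay n c → PartialFn n → Set
Computes {n} P f =
  (0 Data.Nat.< totalWeight P) ×
  (∀ (x y : Vec Bool n) → Dom f x y → 2 * totalWeight P ≤ 3 * weightOut P x y (val f x y))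

-- R^{1-way}(f) ≥ r  iff every correct public-coin one-way protocol has cost ≥ r.
-- We phrase "cost c protocol exists ⇒ bound" directly in the statement.

module Submission where

-- Lower bound R^{1-way}(SETINC^{t+w}_{t,t+w-1}) = Ω(min(t,w)), by reduction from INDEX.
--
-- 1. Embedding.  For m ≤ min(t,w), Alice's z ∈ {0,1}^m becomes
--    X z = ¬z · z · 1^(t-m) · 0^(w-m)  (weight t), and Bob's index i becomes
--    Y i = hole i · 1^m · 1^(t-m) · 1^(w-m)  (weight t+w-1), where hole i is 1^m with a 0
--    at position i.  Then |X z ∧ Y i| = t - [z_i = 0], so SETINC(X z, Y i) = z_i:
--    every SETINC protocol of cost c yields a randomized one-way protocol for INDEX_m.
-- 2. INDEX lower bound by an exponential moment.  For a deterministic protocol with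
--    guess vector h(u) for message u, Σ_z 2^{agree(h(u),z)} = 3^m, so summing over the
--    2^c messages, Σ_z 2^{agree(h(g z),z)} ≤ 2^c 3^m.  A correct randomized protocol has
--    average agreement ≥ 2m/3; comparing agreement a with 2^a above a threshold θ gives
--    2m·2^m·2^θ ≤ 3(θ·2^m·2^θ + (m-θ)·2^c·3^m).
-- 3. Numerics.  With θ = 20s, m = 32s this forces 2^{52s} ≤ 9·2^c·3^{32s}, hence s < c + 4,
--    which yields min(t,w) ≤ 64c as soon as min(t,w) ≥ 256.

open import Defs
open import Data.Nat using (ℕ; _+_; _*_; _∸_; _≤_; _⊓_)
open import Data.Product using (Σ; _×_)

open import Data.Nat using (zero; suc; _<_; _^_; z≤n; s≤s; NonZero; >-nonZero; _≤?_)
open import Data.Nat.Properties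
open import Data.Nat.Tactic.RingSolver using (solve-∀)
open import Data.Bool using (Bool; true; false; not; if_then_else_)
open import Data.Bool.Properties using () renaming (_≟_ to _≟ᵇ_)
open import Data.Fin using (Fin; zero; suc)
open import Data.Vec using (Vec; []; _∷_; _++_; replicate; map; lookup)
open import Data.Vec.Properties using (lookup-map)
open import Data.List using (List; []; _∷_; length) renaming (_++_ to _++ˡ_; map to mapˡ)
open import Data.List.Properties using (length-++; length-map)
open import Data.Product using (_,_; proj₁; proj₂; map₂)
open import Data.Sum using (_⊎_; inj₁; inj₂)
open import Data.Empty using (⊥-elim)
open import Function using (_∘_)
open import Relation.Binary.PropositionalEquality
open import Relation.Nullary.Decidable using (does; yes; no; dec-true; dec-false)

∑ : {A : Set} → List A → (A → ℕ) → ℕ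
∑ [] f = 0
∑ (x ∷ xs) f = f x + ∑ xs f

module _ {A : Set} where

  ∑-cong : (xs : List A) {f g : A → ℕ} → (∀ x → f x ≡ g x) → ∑ xs f ≡ ∑ xs g
  ∑-cong [] eq = refl
  ∑-cong (x ∷ xs) eq = cong₂ _+_ (eq x) (∑-cong xs eq)

  ∑-mono : (xs : List A) {f g : A → ℕ} → (∀ x → f x ≤ g x) → ∑ xs f ≤ ∑ xs g
  ∑-mono [] le = z≤n
  ∑-mono (x ∷ xs) le = +-mono-≤ (le x) (∑-mono xs le)

  ∑-+ : (xs : List A) (f g : A → ℕ) → ∑ xs (λ x → f x + g x) ≡ ∑ xs f + ∑ xs g
  ∑-+ [] f g = refl
  ∑-+ (x ∷ xs) f g rewrite ∑-+ xs f g = +-+-shuffle (f x) (g x) (∑ xs f) (∑ xs g)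
    where
    +-+-shuffle : ∀ a b c d → (a + b) + (c + d) ≡ (a + c) + (b + d)
    +-+-shuffle = solve-∀

  ∑-*ˡ : (xs : List A) (k : ℕ) (f : A → ℕ) → ∑ xs (λ x → k * f x) ≡ k * ∑ xs f
  ∑-*ˡ [] k f = sym (*-zeroʳ k)
  ∑-*ˡ (x ∷ xs) k f rewrite ∑-*ˡ xs k f = sym (*-distribˡ-+ k (f x) (∑ xs f))

  ∑-*ʳ : (xs : List A) (k : ℕ) (f : A → ℕ) → ∑ xs f * k ≡ ∑ xs (λ x → f x * k)
  ∑-*ʳ [] k f = refl
  ∑-*ʳ (x ∷ xs) k f rewrite sym (∑-*ʳ xs k f) = *-distribʳ-+ k (f x) (∑ xs f)

  ∑-const : (xs : List A) (k : ℕ) → ∑ xs (λ _ → k) ≡ length xs * k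
  ∑-const [] k = refl
  ∑-const (x ∷ xs) k = cong (k +_) (∑-const xs k)

  ∑-++ : (xs ys : List A) (f : A → ℕ) → ∑ (xs ++ˡ ys) f ≡ ∑ xs f + ∑ ys f
  ∑-++ [] ys f = refl
  ∑-++ (x ∷ xs) ys f rewrite ∑-++ xs ys f = sym (+-assoc (f x) (∑ xs f) (∑ ys f))

∑-map : {A B : Set} (g : A → B) (xs : List A) (f : B → ℕ) → ∑ (mapˡ g xs) f ≡ ∑ xs (f ∘ g)
∑-map g [] f = refl
∑-map g (x ∷ xs) f = cong (f (g x) +_) (∑-map g xs f)

∑-swap : {A B : Set} (xs : List A) (ys : List B) (f : A → B → ℕ) →
  ∑ xs (λ x → ∑ ys (f x)) ≡ ∑ ys (λ y → ∑ xs (λ x → f x y))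
∑-swap [] ys f = sym (trans (∑-const ys 0) (*-zeroʳ (length ys)))
∑-swap (x ∷ xs) ys f rewrite ∑-swap xs ys f = sym (∑-+ ys (f x) (λ y → ∑ xs (λ x → f x y)))

-- Weighted sums over a weighted list, the form of every "probability" in a
-- public-coin protocol (weights are unnormalised).
weighted : {B : Set} → List (ℕ × B) → (B → ℕ) → ℕ
weighted R f = ∑ R (λ p → proj₁ p * f (proj₂ p))

module _ {B : Set} (R : List (ℕ × B)) where

  weighted-mono : {f g : B → ℕ} → (∀ Q → f Q ≤ g Q) → weighted R f ≤ weighted R g
  weighted-mono le = ∑-mono R (λ p → *-monoʳ-≤ (proj₁ p) (le (proj₂ p)))

  weighted-*ʳ : (f : B → ℕ) (k : ℕ) → weighted R f * k ≡ weighted R (λ Q → f Q * k)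
  weighted-*ʳ f k =
    trans (∑-*ʳ R k _) (∑-cong R (λ p → *-assoc (proj₁ p) (f (proj₂ p)) k))

  weighted-const : (k : ℕ) → weighted R (λ _ → k) ≡ ∑ R proj₁ * k
  weighted-const k = sym (∑-*ʳ R k proj₁)

  ∑-weighted : {A : Set} (xs : List A) (f : A → B → ℕ) →
    ∑ xs (λ x → weighted R (f x)) ≡ weighted R (λ Q → ∑ xs (λ x → f x Q))
  ∑-weighted xs f =
    trans (∑-swap xs R _) (∑-cong R (λ p → ∑-*ˡ xs (proj₁ p) (λ x → f x (proj₂ p))))

fins : (m : ℕ) → List (Fin m)
fins zero = []
fins (suc m) = zero ∷ mapˡ suc (fins m)

length-fins : (m : ℕ) → length (fins m) ≡ m
length-fins zero = refl
length-fins (suc m) = cong suc (trans (length-map suc (fins m)) (length-fins m))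

bits : (m : ℕ) → List (Vec Bool m)
bits zero = [] ∷ []
bits (suc m) = mapˡ (true ∷_) (bits m) ++ˡ mapˡ (false ∷_) (bits m)

∑-bits-suc : (m : ℕ) (f : Vec Bool (suc m) → ℕ) →
  ∑ (bits (suc m)) f ≡ ∑ (bits m) (f ∘ (true ∷_)) + ∑ (bits m) (f ∘ (false ∷_))
∑-bits-suc m f = trans (∑-++ (mapˡ (true ∷_) (bits m)) _ f)
  (cong₂ _+_ (∑-map (true ∷_) (bits m) f) (∑-map (false ∷_) (bits m) f))

length-bits : (m : ℕ) → length (bits m) ≡ 2 ^ m
length-bits zero = refl
length-bits (suc m) = begin
    length (bits (suc m))
  ≡⟨ length-++ (mapˡ (true ∷_) (bits m)) ⟩
    length (mapˡ (true ∷_) (bits m)) + length (mapˡ (false ∷_) (bits m))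
  ≡⟨ cong₂ _+_ (length-map (true ∷_) (bits m)) (length-map (false ∷_) (bits m)) ⟩
    length (bits m) + length (bits m)
  ≡⟨ cong (λ n → n + n) (length-bits m) ⟩
    2 ^ m + 2 ^ m
  ≡⟨ cong (2 ^ m +_) (sym (+-identityʳ (2 ^ m))) ⟩
    2 ^ suc m ∎
  where open ≡-Reasoning

term≤∑-bits : (m : ℕ) (f : Vec Bool m → ℕ) (v : Vec Bool m) → f v ≤ ∑ (bits m) f
term≤∑-bits zero f [] = m≤m+n (f []) 0
term≤∑-bits (suc m) f (true ∷ v) rewrite ∑-bits-suc m f =
  ≤-trans (term≤∑-bits m (f ∘ (true ∷_)) v) (m≤m+n _ _)
term≤∑-bits (suc m) f (false ∷ v) rewrite ∑-bits-suc m f =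
  ≤-trans (term≤∑-bits m (f ∘ (false ∷_)) v) (m≤n+m _ _)

ind : Bool → ℕ
ind true = 1
ind false = 0

match : Bool → Bool → ℕ
match b b' = ind (does (b ≟ᵇ b'))

∣∣-++ : ∀ {k l} (x : Vec Bool k) (y : Vec Bool l) → ∣ x ++ y ∣ ≡ ∣ x ∣ + ∣ y ∣
∣∣-++ [] y = refl
∣∣-++ (true ∷ x) y = cong suc (∣∣-++ x y)
∣∣-++ (false ∷ x) y = ∣∣-++ x y

inter-++ : ∀ {k l} (x x' : Vec Bool k) (y y' : Vec Bool l) →
  inter (x ++ y) (x' ++ y') ≡ inter x x' + inter y y'
inter-++ [] [] y y' = refl
inter-++ (true ∷ x) (true ∷ x') y y' = cong suc (inter-++ x x' y y')
inter-++ (true ∷ x) (false ∷ x') y y' = inter-++ x x' y y'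
inter-++ (false ∷ x) (b ∷ x') y y' = inter-++ x x' y y'

∣ones∣ : ∀ n → ∣ replicate n true ∣ ≡ n
∣ones∣ zero = refl
∣ones∣ (suc n) = cong suc (∣ones∣ n)

∣zeros∣ : ∀ n → ∣ replicate n false ∣ ≡ 0
∣zeros∣ zero = refl
∣zeros∣ (suc n) = ∣zeros∣ n

inter-ones : ∀ {k} (x : Vec Bool k) → inter x (replicate k true) ≡ ∣ x ∣
inter-ones [] = refl
inter-ones (true ∷ x) = cong suc (inter-ones x)
inter-ones (false ∷ x) = inter-ones x

∣∣-not : ∀ {m} (z : Vec Bool m) → ∣ map not z ∣ + ∣ z ∣ ≡ m
∣∣-not [] = refl
∣∣-not {suc m} (true ∷ z) = trans (+-suc ∣ map not z ∣ ∣ z ∣) (cong suc (∣∣-not z))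
∣∣-not (false ∷ z) = cong suc (∣∣-not z)

hole : ∀ {m} → Fin m → Vec Bool m
hole {suc m} zero = false ∷ replicate m true
hole {suc m} (suc i) = true ∷ hole i

∣hole∣ : ∀ {m} (i : Fin m) → suc ∣ hole i ∣ ≡ m
∣hole∣ {suc m} zero = cong suc (∣ones∣ m)
∣hole∣ (suc i) = cong suc (∣hole∣ i)

inter-hole : ∀ {m} (x : Vec Bool m) (i : Fin m) → inter x (hole i) + ind (lookup x i) ≡ ∣ x ∣
inter-hole (true ∷ x) zero = trans (+-comm (inter x _) 1) (cong suc (inter-ones x))
inter-hole (false ∷ x) zero = trans (+-identityʳ _) (inter-ones x)
inter-hole (true ∷ x) (suc i) = cong suc (inter-hole x i)
inter-hole (false ∷ x) (suc i) = inter-hole x i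

∣∣-subst : ∀ {k l} (eq : k ≡ l) (x : Vec Bool k) → ∣ subst (Vec Bool) eq x ∣ ≡ ∣ x ∣
∣∣-subst refl x = refl

inter-subst : ∀ {k l} (eq : k ≡ l) (x y : Vec Bool k) →
  inter (subst (Vec Bool) eq x) (subst (Vec Bool) eq y) ≡ inter x y
inter-subst refl x y = refl

record IndexProtocol (m c : ℕ) : Set where
  field
    send  : Vec Bool m → Vec Bool c
    guess : Vec Bool c → Fin m → Bool
open IndexProtocol

RandIndex : ℕ → ℕ → Set
RandIndex m c = List (ℕ × IndexProtocol m c)

IndexComputes : ∀ {m c} → RandIndex m c → Set
IndexComputes {m} R = ∀ (z : Vec Bool m) (i : Fin m) →
  2 * ∑ R proj₁ ≤ 3 * weighted R (λ Q → match (guess Q (send Q z) i) (lookup z i))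

agree : ∀ {m} → (Fin m → Bool) → Vec Bool m → ℕ
agree {m} h z = ∑ (fins m) (λ i → match (h i) (lookup z i))

agree-∷ : ∀ {m} (h : Fin (suc m) → Bool) (b : Bool) (z : Vec Bool m) →
  agree h (b ∷ z) ≡ match (h zero) b + agree (h ∘ suc) z
agree-∷ {m} h b z = cong (match (h zero) b +_) (∑-map suc (fins m) _)

agree≤ : ∀ {m} (h : Fin m → Bool) (z : Vec Bool m) → agree h z ≤ m
agree≤ h [] = z≤n
agree≤ h (b ∷ z) rewrite agree-∷ h b z = +-mono-≤ (match≤1 (h zero) b) (agree≤ (h ∘ suc) z)
  where
  match≤1 : ∀ b b' → match b b' ≤ 1
  match≤1 true true = s≤s z≤n
  match≤1 true false = z≤n
  match≤1 false true = z≤n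
  match≤1 false false = s≤s z≤n

-- Exponential moment of the agreement with a fixed guess vector: each position
-- contributes a factor 2^1 + 2^0 = 3.
∑-2^agree : ∀ m (h : Fin m → Bool) → ∑ (bits m) (λ z → 2 ^ agree h z) ≡ 3 ^ m
∑-2^agree zero h = refl
∑-2^agree (suc m) h = begin
    ∑ (bits (suc m)) (λ z → 2 ^ agree h z)
  ≡⟨ ∑-bits-suc m _ ⟩
    ∑ (bits m) (λ z → 2 ^ agree h (true ∷ z)) + ∑ (bits m) (λ z → 2 ^ agree h (false ∷ z))
  ≡⟨ cong₂ _+_ (column true) (column false) ⟩
    2 ^ match (h zero) true * 3 ^ m + 2 ^ match (h zero) false * 3 ^ m
  ≡⟨ sym (*-distribʳ-+ (3 ^ m) (2 ^ match (h zero) true) _) ⟩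
    (2 ^ match (h zero) true + 2 ^ match (h zero) false) * 3 ^ m
  ≡⟨ cong (_* 3 ^ m) (both-bits (h zero)) ⟩
    3 ^ suc m ∎
  where
  open ≡-Reasoning
  column : ∀ b → ∑ (bits m) (λ z → 2 ^ agree h (b ∷ z)) ≡ 2 ^ match (h zero) b * 3 ^ m
  column b = begin
      ∑ (bits m) (λ z → 2 ^ agree h (b ∷ z))
    ≡⟨ ∑-cong (bits m) (λ z → trans (cong (2 ^_) (agree-∷ h b z))
                                     (^-distribˡ-+-* 2 (match (h zero) b) _)) ⟩
      ∑ (bits m) (λ z → 2 ^ match (h zero) b * 2 ^ agree (h ∘ suc) z)
    ≡⟨ ∑-*ˡ (bits m) (2 ^ match (h zero) b) (λ z → 2 ^ agree (h ∘ suc) z) ⟩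
      2 ^ match (h zero) b * ∑ (bits m) (λ z → 2 ^ agree (h ∘ suc) z)
    ≡⟨ cong (2 ^ match (h zero) b *_) (∑-2^agree m (h ∘ suc)) ⟩
      2 ^ match (h zero) b * 3 ^ m ∎
  both-bits : ∀ g → 2 ^ match g true + 2 ^ match g false ≡ 3
  both-bits true = refl
  both-bits false = refl

-- With c-bit messages Bob has at most 2^c guess vectors, so the exponential moment
-- of a deterministic protocol's agreement is at most 2^c · 3^m.
∑-2^agree-messages : ∀ m c (g : Vec Bool m → Vec Bool c) (h : Vec Bool c → Fin m → Bool) →
  ∑ (bits m) (λ z → 2 ^ agree (h (g z)) z) ≤ 2 ^ c * 3 ^ m
∑-2^agree-messages m c g h = begin
    ∑ (bits m) (λ z → 2 ^ agree (h (g z)) z)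
  ≤⟨ ∑-mono (bits m) (λ z → term≤∑-bits c (λ u → 2 ^ agree (h u) z) (g z)) ⟩
    ∑ (bits m) (λ z → ∑ (bits c) (λ u → 2 ^ agree (h u) z))
  ≡⟨ ∑-swap (bits m) (bits c) _ ⟩
    ∑ (bits c) (λ u → ∑ (bits m) (λ z → 2 ^ agree (h u) z))
  ≡⟨ ∑-cong (bits c) (λ u → ∑-2^agree m (h u)) ⟩
    ∑ (bits c) (λ _ → 3 ^ m)
  ≡⟨ trans (∑-const (bits c) _) (cong (_* 3 ^ m) (length-bits c)) ⟩
    2 ^ c * 3 ^ m ∎
  where open ≤-Reasoning

-- Comparing a count a ≤ θ + d with 2^a: below the threshold θ the left side is at
-- most θ·2^θ, above it 2^θ ≤ 2^a.
linear≤exp : ∀ θ d a → a ≤ θ + d → a * 2 ^ θ ≤ θ * 2 ^ θ + d * 2 ^ a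
linear≤exp θ d a a≤θ+d with a ≤? θ
... | yes a≤θ = ≤-trans (*-monoˡ-≤ (2 ^ θ) a≤θ) (m≤m+n _ _)
... | no a≰θ = begin
    a * 2 ^ θ                ≤⟨ *-monoˡ-≤ (2 ^ θ) a≤θ+d ⟩
    (θ + d) * 2 ^ θ          ≡⟨ *-distribʳ-+ (2 ^ θ) θ d ⟩
    θ * 2 ^ θ + d * 2 ^ θ    ≤⟨ +-monoʳ-≤ (θ * 2 ^ θ) (*-monoʳ-≤ d 2^θ≤2^a) ⟩
    θ * 2 ^ θ + d * 2 ^ a    ∎
  where
  open ≤-Reasoning
  2^θ≤2^a : 2 ^ θ ≤ 2 ^ a
  2^θ≤2^a = ^-monoʳ-≤ 2 (<⇒≤ (≰⇒> a≰θ))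

module _ {c : ℕ} where

  successes : ∀ {m} → IndexProtocol m c → Vec Bool m → ℕ
  successes Q z = agree (guess Q (send Q z)) z

  successes-bound : ∀ θ d (Q : IndexProtocol (θ + d) c) →
    ∑ (bits (θ + d)) (successes Q) * 2 ^ θ
      ≤ 2 ^ (θ + d) * (θ * 2 ^ θ) + d * (2 ^ c * 3 ^ (θ + d))
  successes-bound θ d Q = begin
      ∑ Z (successes Q) * 2 ^ θ
    ≡⟨ ∑-*ʳ Z (2 ^ θ) (successes Q) ⟩
      ∑ Z (λ z → successes Q z * 2 ^ θ)
    ≤⟨ ∑-mono Z (λ z → linear≤exp θ d _ (agree≤ (guess Q (send Q z)) z)) ⟩
      ∑ Z (λ z → θ * 2 ^ θ + d * 2 ^ successes Q z)
    ≡⟨ ∑-+ Z _ _ ⟩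
      ∑ Z (λ _ → θ * 2 ^ θ) + ∑ Z (λ z → d * 2 ^ successes Q z)
    ≡⟨ cong₂ _+_ (trans (∑-const Z _) (cong (_* (θ * 2 ^ θ)) (length-bits (θ + d))))
                 (∑-*ˡ Z d _) ⟩
      2 ^ (θ + d) * (θ * 2 ^ θ) + d * ∑ Z (λ z → 2 ^ successes Q z)
    ≤⟨ +-monoʳ-≤ _ (*-monoʳ-≤ d (∑-2^agree-messages (θ + d) c (send Q) (guess Q))) ⟩
      2 ^ (θ + d) * (θ * 2 ^ θ) + d * (2 ^ c * 3 ^ (θ + d)) ∎
    where
    open ≤-Reasoning
    Z : List (Vec Bool (θ + d))
    Z = bits (θ + d)

  expected-successes : ∀ {m} (R : RandIndex m c) → IndexComputes R → (z : Vec Bool m) →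
    m * (2 * ∑ R proj₁) ≤ 3 * weighted R (λ Q → successes Q z)
  expected-successes {m} R computes z = begin
      m * (2 * ∑ R proj₁)
    ≡⟨ cong (_* (2 * ∑ R proj₁)) (sym (length-fins m)) ⟩
      length (fins m) * (2 * ∑ R proj₁)
    ≡⟨ sym (∑-const (fins m) _) ⟩
      ∑ (fins m) (λ _ → 2 * ∑ R proj₁)
    ≤⟨ ∑-mono (fins m) (computes z) ⟩
      ∑ (fins m) (λ i → 3 * weighted R (λ Q → correct Q i))
    ≡⟨ ∑-*ˡ (fins m) 3 _ ⟩
      3 * ∑ (fins m) (λ i → weighted R (λ Q → correct Q i))
    ≡⟨ cong (3 *_) (∑-weighted R (fins m) (λ i Q → correct Q i)) ⟩
      3 * weighted R (λ Q → successes Q z) ∎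
    where
    open ≤-Reasoning
    correct : IndexProtocol m c → Fin m → ℕ
    correct Q i = match (guess Q (send Q z) i) (lookup z i)

  -- Lower bound for randomized INDEX: the averaging bound summed over all inputs,
  -- against the deterministic bound for every protocol in the support.
  index-lower-bound : ∀ θ d (R : RandIndex (θ + d) c) → 0 < ∑ R proj₁ → IndexComputes R →
    2 ^ (θ + d) * ((θ + d) * 2) * 2 ^ θ
      ≤ 3 * (2 ^ (θ + d) * (θ * 2 ^ θ) + d * (2 ^ c * 3 ^ (θ + d)))
  index-lower-bound θ d R W>0 computes = *-cancelˡ-≤ W (begin
      W * (2 ^ m * (m * 2) * 2 ^ θ)
    ≡⟨ reorder W (2 ^ m) m (2 ^ θ) ⟩
      2 ^ m * (m * (2 * W)) * 2 ^ θ
    ≡⟨ cong (_* 2 ^ θ) (sym (trans (∑-const Z _) (cong (_* (m * (2 * W))) (length-bits m)))) ⟩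
      ∑ Z (λ _ → m * (2 * W)) * 2 ^ θ
    ≤⟨ *-monoˡ-≤ (2 ^ θ) (∑-mono Z (expected-successes R computes)) ⟩
      ∑ Z (λ z → 3 * weighted R (λ Q → successes Q z)) * 2 ^ θ
    ≡⟨ cong (_* 2 ^ θ) (trans (∑-*ˡ Z 3 _)
                             (cong (3 *_) (∑-weighted R Z (λ z Q → successes Q z)))) ⟩
      3 * weighted R (λ Q → ∑ Z (successes Q)) * 2 ^ θ
    ≡⟨ trans (*-assoc 3 (weighted R (λ Q → ∑ Z (successes Q))) (2 ^ θ))
             (cong (3 *_) (weighted-*ʳ R (λ Q → ∑ Z (successes Q)) (2 ^ θ))) ⟩
      3 * weighted R (λ Q → ∑ Z (successes Q) * 2 ^ θ)
    ≤⟨ *-monoʳ-≤ 3 (weighted-mono R (successes-bound θ d)) ⟩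
      3 * weighted R (λ _ → B)
    ≡⟨ cong (3 *_) (weighted-const R B) ⟩
      3 * (W * B)
    ≡⟨ *-comm-middle 3 W B ⟩
      W * (3 * B) ∎)
    where
    open ≤-Reasoning
    m W B : ℕ
    m = θ + d
    W = ∑ R proj₁
    Z : List (Vec Bool m)
    Z = bits m
    B = 2 ^ m * (θ * 2 ^ θ) + d * (2 ^ c * 3 ^ m)
    instance
      W≢0 : NonZero W
      W≢0 = >-nonZero W>0
    reorder : ∀ w p m t → w * (p * (m * 2) * t) ≡ p * (m * (2 * w)) * t
    reorder = solve-∀
    *-comm-middle : ∀ a b x → a * (b * x) ≡ b * (a * x)
    *-comm-middle = solve-∀

short-by-bit-dom : ∀ I t b → I + ind b ≡ t → (I ≡ t) ⊎ (suc I ≡ t)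
short-by-bit-dom I t true eq = inj₂ (trans (+-comm 1 I) eq)
short-by-bit-dom I t false eq = inj₁ (trans (sym (+-identityʳ I)) eq)

short-by-bit-val : ∀ I t b → I + ind (not b) ≡ t → does (I ≟ t) ≡ b
short-by-bit-val I t true eq = dec-true (I ≟ t) (trans (sym (+-identityʳ I)) eq)
short-by-bit-val I t false eq =
  dec-false (I ≟ t) (λ I≡t → 1+n≢n (trans (trans (+-comm 1 I) eq) (sym I≡t)))

module Embedding {t w m : ℕ} (m≤t : m ≤ t) (m≤w : m ≤ w) where

  -- Padding lengths: X and Y are filled up to weights t and t + w - 1.
  a b : ℕ
  a = t ∸ m
  b = w ∸ m

  len : m + (m + (a + b)) ≡ t + w
  len = trans (regroup m a b) (cong₂ _+_ (m+[n∸m]≡n m≤t) (m+[n∸m]≡n m≤w))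
    where
    regroup : ∀ m a b → m + (m + (a + b)) ≡ (m + a) + (m + b)
    regroup = solve-∀

  X : Vec Bool m → Vec Bool (t + w)
  X z = subst (Vec Bool) len (map not z ++ (z ++ (replicate a true ++ replicate b false)))

  Y : Fin m → Vec Bool (t + w)
  Y i = subst (Vec Bool) len (hole i ++ (replicate m true ++ (replicate a true ++ replicate b true)))

  ∣X∣ : ∀ z → ∣ X z ∣ ≡ t
  ∣X∣ z = begin
      ∣ X z ∣
    ≡⟨ ∣∣-subst len _ ⟩
      ∣ map not z ++ (z ++ (replicate a true ++ replicate b false)) ∣
    ≡⟨ ∣∣-++ (map not z) _ ⟩
      ∣ map not z ∣ + ∣ z ++ (replicate a true ++ replicate b false) ∣
    ≡⟨ cong (∣ map not z ∣ +_) (trans (∣∣-++ z _) (cong (∣ z ∣ +_) padding)) ⟩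
      ∣ map not z ∣ + (∣ z ∣ + a)
    ≡⟨ sym (+-assoc ∣ map not z ∣ ∣ z ∣ a) ⟩
      ∣ map not z ∣ + ∣ z ∣ + a
    ≡⟨ cong (_+ a) (∣∣-not z) ⟩
      m + a
    ≡⟨ m+[n∸m]≡n m≤t ⟩
      t ∎
    where
    open ≡-Reasoning
    padding : ∣ replicate a true ++ replicate b false ∣ ≡ a
    padding = trans (∣∣-++ (replicate a true) _)
                    (trans (cong₂ _+_ (∣ones∣ a) (∣zeros∣ b)) (+-identityʳ a))

  ∣Y∣ : ∀ i → ∣ Y i ∣ ≡ t + w ∸ 1
  ∣Y∣ i = begin
      ∣ Y i ∣
    ≡⟨ ∣∣-subst len _ ⟩
      ∣ hole i ++ (replicate m true ++ (replicate a true ++ replicate b true)) ∣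
    ≡⟨ trans (∣∣-++ (hole i) _) (cong (∣ hole i ∣ +_) padding) ⟩
      ∣ hole i ∣ + (m + (a + b))
    ≡⟨ cong (λ k → k + (m + (a + b)) ∸ 1) (∣hole∣ i) ⟩
      m + (m + (a + b)) ∸ 1
    ≡⟨ cong (_∸ 1) len ⟩
      t + w ∸ 1 ∎
    where
    open ≡-Reasoning
    padding : ∣ replicate m true ++ (replicate a true ++ replicate b true) ∣ ≡ m + (a + b)
    padding = trans (∣∣-++ (replicate m true) _)
      (cong₂ _+_ (∣ones∣ m) (trans (∣∣-++ (replicate a true) _) (cong₂ _+_ (∣ones∣ a) (∣ones∣ b))))

  -- The only position of X z missed by Y i is the i-th bit of ¬z.
  inter-XY : ∀ z i → inter (X z) (Y i) + ind (not (lookup z i)) ≡ t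
  inter-XY z i = begin
      inter (X z) (Y i) + ind (not (lookup z i))
    ≡⟨ cong (_+ ind (not (lookup z i)))
            (trans (inter-subst len _ _) (inter-++ (map not z) (hole i) _ _)) ⟩
      inter (map not z) (hole i) + inter (z ++ pad₁) (replicate m true ++ pad₂)
        + ind (not (lookup z i))
    ≡⟨ cong (λ k → inter (map not z) (hole i) + k + ind (not (lookup z i))) padding ⟩
      inter (map not z) (hole i) + (∣ z ∣ + a) + ind (not (lookup z i))
    ≡⟨ regroup (inter (map not z) (hole i)) ∣ z ∣ a _ ⟩
      inter (map not z) (hole i) + ind (not (lookup z i)) + ∣ z ∣ + a
    ≡⟨ cong (λ k → inter (map not z) (hole i) + ind k + ∣ z ∣ + a) (sym (lookup-map i not z)) ⟩
      inter (map not z) (hole i) + ind (lookup (map not z) i) + ∣ z ∣ + a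
    ≡⟨ cong (λ k → k + ∣ z ∣ + a) (inter-hole (map not z) i) ⟩
      ∣ map not z ∣ + ∣ z ∣ + a
    ≡⟨ cong (_+ a) (∣∣-not z) ⟩
      m + a
    ≡⟨ m+[n∸m]≡n m≤t ⟩
      t ∎
    where
    open ≡-Reasoning
    pad₁ pad₂ : Vec Bool (a + b)
    pad₁ = replicate a true ++ replicate b false
    pad₂ = replicate a true ++ replicate b true
    padding : inter (z ++ pad₁) (replicate m true ++ pad₂) ≡ ∣ z ∣ + a
    padding = begin
        inter (z ++ pad₁) (replicate m true ++ pad₂)
      ≡⟨ inter-++ z (replicate m true) pad₁ pad₂ ⟩
        inter z (replicate m true) + inter pad₁ pad₂
      ≡⟨ cong₂ _+_ (inter-ones z) (inter-++ (replicate a true) (replicate a true) _ _) ⟩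
        ∣ z ∣ + (inter (replicate a true) (replicate a true)
                 + inter (replicate b false) (replicate b true))
      ≡⟨ cong (∣ z ∣ +_) (cong₂ _+_ (trans (inter-ones (replicate a true)) (∣ones∣ a))
                                     (trans (inter-ones (replicate b false)) (∣zeros∣ b))) ⟩
        ∣ z ∣ + (a + 0)
      ≡⟨ cong (∣ z ∣ +_) (+-identityʳ a) ⟩
        ∣ z ∣ + a ∎
    regroup : ∀ h n a j → h + (n + a) + j ≡ h + j + n + a
    regroup = solve-∀

  inDomain : ∀ z i → Dom (SETINC (t + w) t (t + w ∸ 1)) (X z) (Y i)
  inDomain z i = ∣X∣ z , ∣Y∣ i , short-by-bit-dom _ t (not (lookup z i)) (inter-XY z i)

  value : ∀ z i → val (SETINC (t + w) t (t + w ∸ 1)) (X z) (Y i) ≡ lookup z i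
  value z i = short-by-bit-val _ t (lookup z i) (inter-XY z i)

  toIndex : ∀ {c} → OneWayDet (t + w) c → IndexProtocol m c
  toIndex Q = record { send = alice Q ∘ X ; guess = λ u i → bob Q (Y i) u }

  reduce : ∀ {c} → RandOneWay (t + w) c → RandIndex m c
  reduce = mapˡ (map₂ toIndex)

totalWeight-∑ : ∀ {n c} (P : RandOneWay n c) → totalWeight P ≡ ∑ P proj₁
totalWeight-∑ [] = refl
totalWeight-∑ ((k , Q) ∷ P) = cong (k +_) (totalWeight-∑ P)

weightOut-weighted : ∀ {n c} (P : RandOneWay n c) x y b →
  weightOut P x y b ≡ weighted P (λ Q → match (run Q x y) b)
weightOut-weighted [] x y b = refl
weightOut-weighted ((k , Q) ∷ P) x y b =
  cong₂ _+_ (if-as-product (does (run Q x y ≟ᵇ b))) (weightOut-weighted P x y b)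
  where
  if-as-product : ∀ d → (if d then k else 0) ≡ k * ind d
  if-as-product true = sym (*-identityʳ k)
  if-as-product false = sym (*-zeroʳ k)

reduce-computes : ∀ {t w m c} (m≤t : m ≤ t) (m≤w : m ≤ w) (P : RandOneWay (t + w) c) →
  Computes P (SETINC (t + w) t (t + w ∸ 1)) →
  0 < ∑ (Embedding.reduce m≤t m≤w P) proj₁ × IndexComputes (Embedding.reduce m≤t m≤w P)
reduce-computes {t} {w} m≤t m≤w P (W>0 , correct) =
  subst (0 <_) same-weight W>0 , λ z i →
    subst₂ (λ W S → 2 * W ≤ 3 * S) same-weight (same-successes z i)
      (correct (X z) (Y i) (inDomain z i))
  where
  open Embedding m≤t m≤w
  same-weight : totalWeight P ≡ ∑ (reduce P) proj₁
  same-weight = trans (totalWeight-∑ P) (sym (∑-map (map₂ toIndex) P proj₁))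
  same-successes : ∀ z i →
    weightOut P (X z) (Y i) (val (SETINC (t + w) t (t + w ∸ 1)) (X z) (Y i))
      ≡ weighted (reduce P) (λ Q → match (guess Q (send Q z) i) (lookup z i))
  same-successes z i = begin
      weightOut P (X z) (Y i) (val (SETINC (t + w) t (t + w ∸ 1)) (X z) (Y i))
    ≡⟨ cong (weightOut P (X z) (Y i)) (value z i) ⟩
      weightOut P (X z) (Y i) (lookup z i)
    ≡⟨ weightOut-weighted P (X z) (Y i) (lookup z i) ⟩
      weighted P (λ Q → match (run Q (X z) (Y i)) (lookup z i))
    ≡⟨ sym (∑-map (map₂ toIndex) P _) ⟩
      weighted (reduce P) (λ Q → match (guess Q (send Q z) i) (lookup z i)) ∎
    where open ≡-Reasoning

^-distribʳ-* : ∀ a b s → (a * b) ^ s ≡ a ^ s * b ^ s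
^-distribʳ-* a b zero = refl
^-distribʳ-* a b (suc s) rewrite ^-distribʳ-* a b s = interchange a b (a ^ s) (b ^ s)
  where
  interchange : ∀ a b x y → a * b * (x * y) ≡ a * x * (b * y)
  interchange = solve-∀

-- Since 2 · 3^32 ≤ 2^52, the bound 2^{52s} ≤ 9 · 2^c · 3^{32s} forces 2^s ≤ 9 · 2^c < 2^{4+c}.
exponent-bound : ∀ s c → 2 ^ (52 * s) ≤ 9 * (2 ^ c * 3 ^ (32 * s)) → s < 4 + c
exponent-bound s c bound with 4 + c ≤? s
... | no s≱4+c = ≰⇒> s≱4+c
... | yes 4+c≤s = ⊥-elim (<-irrefl refl (<-≤-trans 2^s<2^[4+c] (^-monoʳ-≤ 2 4+c≤s)))
  where
  G : ℕ
  G = (3 ^ 32) ^ s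
  instance
    G≢0 : NonZero G
    G≢0 = >-nonZero (m^n>0 (3 ^ 32) s)
  scaled : 2 ^ s * G ≤ 9 * 2 ^ c * G
  scaled = begin
      2 ^ s * G               ≡⟨ sym (^-distribʳ-* 2 (3 ^ 32) s) ⟩
      (2 * 3 ^ 32) ^ s        ≤⟨ ^-monoˡ-≤ s (≤ᵇ⇒≤ (2 * 3 ^ 32) (2 ^ 52) _) ⟩
      (2 ^ 52) ^ s            ≡⟨ ^-*-assoc 2 52 s ⟩
      2 ^ (52 * s)            ≤⟨ bound ⟩
      9 * (2 ^ c * 3 ^ (32 * s)) ≡⟨ cong (λ k → 9 * (2 ^ c * k)) (sym (^-*-assoc 3 32 s)) ⟩
      9 * (2 ^ c * G)         ≡⟨ sym (*-assoc 9 (2 ^ c) G) ⟩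
      9 * 2 ^ c * G           ∎
    where open ≤-Reasoning
  2^s<2^[4+c] : 2 ^ s < 2 ^ (4 + c)
  2^s<2^[4+c] = begin-strict
      2 ^ s                  ≤⟨ *-cancelʳ-≤ (2 ^ s) (9 * 2 ^ c) G scaled ⟩
      9 * 2 ^ c              <⟨ *-monoˡ-< (2 ^ c) {{>-nonZero (m^n>0 2 c)}} {9} {16} (≤ᵇ⇒≤ 10 16 _) ⟩
      16 * 2 ^ c             ≡⟨ sixteen (2 ^ c) ⟩
      2 ^ (4 + c)            ∎
    where
    open ≤-Reasoning
    sixteen : ∀ x → 16 * x ≡ 2 * (2 * (2 * (2 * x)))
    sixteen = solve-∀

-- The INDEX bound at θ = 20s, d = 12s reads 64s·E ≤ 60s·E + 36s·G with E = P·T,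
-- hence E ≤ 9G.
solve-for-E : ∀ s P T G .{{_ : NonZero s}} →
  P * ((20 * s + 12 * s) * 2) * T ≤ 3 * (P * (20 * s * T) + 12 * s * G) → P * T ≤ 9 * G
solve-for-E s P T G bound =
  *-cancelˡ-≤ (4 * s) {{m*n≢0 4 s}}
    (+-cancelˡ-≤ (60 * s * (P * T)) _ _ (subst₂ _≤_ (lhs s P T) (rhs s P T G) bound))
  where
  lhs : ∀ s P T → P * ((20 * s + 12 * s) * 2) * T ≡ 60 * s * (P * T) + 4 * s * (P * T)
  lhs = solve-∀
  rhs : ∀ s P T G → 3 * (P * (20 * s * T) + 12 * s * G) ≡ 60 * s * (P * T) + 4 * s * (9 * G)
  rhs = solve-∀

-- A cost-c public-coin protocol for SETINC^{t+w}_{t,t+w-1} with 32s ≤ min(t,w)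
-- forces s < c + 4: embed INDEX_{32s} and apply its lower bound with θ = 20s.
setinc-cost : ∀ {t w c} s .{{_ : NonZero s}} (P : RandOneWay (t + w) c) →
  Computes P (SETINC (t + w) t (t + w ∸ 1)) → 32 * s ≤ t ⊓ w → s < 4 + c
setinc-cost {t} {w} {c} s P computes 32s≤min = exponent-bound s c (begin
    2 ^ (52 * s)
  ≡⟨ trans (cong (2 ^_) (exponents s)) (^-distribˡ-+-* 2 (20 * s + 12 * s) (20 * s)) ⟩
    2 ^ (20 * s + 12 * s) * 2 ^ (20 * s)
  ≤⟨ solve-for-E s (2 ^ (20 * s + 12 * s)) (2 ^ (20 * s)) (2 ^ c * 3 ^ (20 * s + 12 * s))
       (index-lower-bound (20 * s) (12 * s) R W>0 index-computes) ⟩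
    9 * (2 ^ c * 3 ^ (20 * s + 12 * s))
  ≡⟨ cong (λ k → 9 * (2 ^ c * 3 ^ k)) (sym (split s)) ⟩
    9 * (2 ^ c * 3 ^ (32 * s)) ∎)
  where
  open ≤-Reasoning
  split : ∀ s → 32 * s ≡ 20 * s + 12 * s
  split = solve-∀
  exponents : ∀ s → 52 * s ≡ (20 * s + 12 * s) + 20 * s
  exponents = solve-∀
  m≤min : 20 * s + 12 * s ≤ t ⊓ w
  m≤min = subst (_≤ t ⊓ w) (split s) 32s≤min
  m≤t : 20 * s + 12 * s ≤ t
  m≤t = ≤-trans m≤min (m⊓n≤m t w)
  m≤w : 20 * s + 12 * s ≤ w
  m≤w = ≤-trans m≤min (m⊓n≤n t w)
  R : RandIndex (20 * s + 12 * s) c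
  R = Embedding.reduce m≤t m≤w P
  W>0 : 0 < ∑ R proj₁
  W>0 = proj₁ (reduce-computes m≤t m≤w P computes)
  index-computes : IndexComputes R
  index-computes = proj₂ (reduce-computes m≤t m≤w P computes)

-- min(t,w) ≤ 64c once min(t,w) ≥ 256: otherwise 32(c+4) ≤ min(t,w), as it lies
-- halfway between 256 and 64c.
proposition4p20 : Σ ℕ λ K → Σ ℕ λ N → (t w c : ℕ) → (P : RandOneWay (t + w) c) →
    Computes P (SETINC (t + w) t (t + w ∸ 1)) → N ≤ t ⊓ w → t ⊓ w ≤ K * c
proposition4p20 = 64 , 256 , bound
  where
  halfway : ∀ c n → 256 ≤ n → 64 * c ≤ n → 32 * (4 + c) ≤ n
  halfway c n 256≤n 64c≤n =
    *-cancelˡ-≤ 2 (subst₂ _≤_ (double-sum c) (double n) (+-mono-≤ 256≤n 64c≤n))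
    where
    double-sum : ∀ c → 256 + 64 * c ≡ 2 * (32 * (4 + c))
    double-sum = solve-∀
    double : ∀ n → n + n ≡ 2 * n
    double = solve-∀
  bound : (t w c : ℕ) → (P : RandOneWay (t + w) c) →
    Computes P (SETINC (t + w) t (t + w ∸ 1)) → 256 ≤ t ⊓ w → t ⊓ w ≤ 64 * c
  bound t w c P computes 256≤min with t ⊓ w ≤? 64 * c
  ... | yes small = small
  ... | no large = ⊥-elim (<-irrefl refl
          (setinc-cost (4 + c) P computes (halfway c (t ⊓ w) 256≤min (<⇒≤ (≰⇒> large)))))
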